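{- Let $\alpha\in\mathbb{Q}\setminus\mathbb{Z}_{\le0}$. There exists a constant $M(\alpha)>0$ such that for every prime $p$ with $\alpha\in\mathbb{Z}_p$ and every integer $\ell\ge1$, $$\frac1{M(\alpha)}\le\mathfrak{D}_p^\ell(\alpha)+\frac{\lfloor1-\alpha\rfloor}{p^\ell}\le1.$$
   Context: For a prime $p$ and $x\in\mathbb{Q}\cap\mathbb{Z}_p$, $\mathfrak{D}_p(x)$ is the unique element of $\mathbb{Q}\cap\mathbb{Z}_p$ with $p\mathfrak{D}_p(x)-x\in\{0,\dots,p-1\}$; $\mathfrak{D}_p^\ell$ is its $\ell$-th iterate. -}

module Defs where

open import Data.Nat as ℕ using (ℕ; zero; suc; _∸_)
open import Data.Nat.Divisibility using (_∣_; _∣?_)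
open import Data.Nat.Properties using (m^n≢0)
open import Data.Integer as ℤ using (ℤ; +_)
open import Data.Rational using (ℚ; ↥_; ↧ₙ_; _+_; _*_; _/_; 0ℚ)
open import Data.Bool using (if_then_else_)
open import Relation.Nullary using (¬_)
open import Relation.Nullary.Decidable using (does)

InZp : ℕ → ℚ → Set
InZp p x = ¬ (p ∣ ↧ₙ x)

ℕtoℚ : ℕ → ℚ
ℕtoℚ n = (+ n) / 1

digitSearch : ℕ → ℚ → ℕ → ℕ
digitSearch p x zero = 0
digitSearch p x (suc k) =
  if does (p ∣? ℤ.∣ ↥ (x + ℕtoℚ (p ∸ suc k)) ∣)
  then p ∸ suc k
  else digitSearch p x k

-- The unique r ∈ {0,…,p-1} with x + r ∈ pℤ_p.
digit : ℕ → ℚ → ℕ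
digit p x = digitSearch p x p

-- Dwork map: 𝔇_p(x) = (x + r)/p, so that p·𝔇_p(x) − x = r ∈ {0,…,p-1}.
-- (p = 0 is a junk case; only primes are used.)
𝔇 : ℕ → ℚ → ℚ
𝔇 zero x = x
𝔇 (suc q) x = (x + ℕtoℚ (digit (suc q) x)) * ((+ 1) / suc q)

𝔇^ : ℕ → ℕ → ℚ → ℚ
𝔇^ p zero x = x
𝔇^ p (suc ℓ) x = 𝔇 p (𝔇^ p ℓ x)

-- 1 / p^ℓ as a rational (junk 0 for p = 0).
invPow : ℕ → ℕ → ℚ
invPow zero ℓ = 0ℚ
invPow (suc q) ℓ = ((+ 1) / (suc q ℕ.^ ℓ)) {{m^n≢0 (suc q) ℓ}}

module Submission where

-- Write α = a/b in lowest terms and k = ⌊1 − α⌋, so that 1 ≤ s := a + k b ≤ b. For p ∤ b an induction on ℓ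
-- shows 𝔇_p^ℓ(α) = m/b with p^ℓ m = a + N b and 0 ≤ N < p^ℓ: the digit r of m/b makes p divide m + r b
-- (b is invertible mod p, so some r < p works), and N becomes N + r p^ℓ. Hence
-- 𝔇_p^ℓ(α) + k/p^ℓ = (s + N b)/(b p^ℓ), which is at most (N + 1) b/(b p^ℓ) ≤ 1. For the lower bound,
-- m ≠ 0 since α is not a non-positive integer, so p^ℓ ≤ |p^ℓ m| = |s + N b − k b| ≤ (s + N b)(1 + |k| b),
-- which gives the constant M(α) = b (1 + |k| b).

open import Data.Bool.Base using (if_then_else_)
open import Data.Empty using (⊥-elim)
open import Data.Integer.Base as ℤ using (ℤ; +_; 0ℤ; 1ℤ; ∣_∣)
import Data.Integer.DivMod as ℤ
import Data.Integer.Divisibility.Signed as ℤ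
import Data.Integer.Properties as ℤ
open import Data.Integer.Tactic.RingSolver using (solve)
open import Data.List.Base using (_∷_; [])
open import Data.Nat.Base as ℕ using (ℕ; zero; suc; _∸_)
open import Data.Nat.Coprimality as C using (Coprime; coprime-Bézout; coprime-divisor; recompute)
open import Data.Nat.Divisibility using (_∣_; _∣?_; ∣-trans; m∣m*n; n∣m*n)
open import Data.Nat.GCD using (module Bézout)
open import Data.Nat.Primality using (Prime; euclidsLemma; prime⇒irreducible; prime⇒nonZero)
import Data.Nat.Properties as ℕ
open import Data.Product using (Σ; _×_; _,_; proj₁; proj₂; ∃-syntax)
open import Data.Rational
  using (ℚ; mkℚ; toℚᵘ; ↥_; ↧ₙ_; _+_; _*_; _-_; -_; _/_; _≤_; _<_; *<*; 0ℚ; 1ℚ; 1/_; floor; >-nonZero)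
import Data.Rational.Properties as ℚ
open import Data.Rational.Unnormalised as ℚᵘ using (*≡*; *≤*)
import Data.Rational.Unnormalised.Properties as ℚᵘ
open import Data.Sum using (inj₁; inj₂)
open import Function.Base using (id; _∘_)
open import Relation.Binary.PropositionalEquality
  using (_≡_; _≢_; refl; sym; trans; cong; cong₂; subst; subst₂; module ≡-Reasoning)
open import Relation.Nullary using (¬_; Dec; yes; no; does)

open import Algebra.Properties.CommutativeSemigroup ℤ.*-commutativeSemigroup using (xy∙z≈xz∙y)
open import Defs

private
  [i+j]-j≡i : ∀ i j → i ℤ.+ j ℤ.- j ≡ i
  [i+j]-j≡i i j = solve (i ∷ j ∷ [])

  pos-1+*≡* : ∀ x m y n → 1 ℕ.+ x ℕ.* m ≡ y ℕ.* n → 1ℤ ℤ.+ + x ℤ.* + m ≡ + y ℤ.* + n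
  pos-1+*≡* x m y n eq =
    trans (cong (ℤ._+_ 1ℤ) (sym (ℤ.pos-* x m))) (trans (cong +_ eq) (ℤ.pos-* y n))

toℚᵘ-/ : ∀ i n .{{_ : ℕ.NonZero n}} → toℚᵘ (i / n) ℚᵘ.≃ i ℚᵘ./ n
toℚᵘ-/ i (suc n) = ℚ.toℚᵘ-fromℚᵘ (i ℚᵘ./ suc n)

*≡*-/ : ∀ {i j m n} .{{_ : ℕ.NonZero m}} .{{_ : ℕ.NonZero n}} →
        i ℤ.* + n ≡ j ℤ.* + m → i ℚᵘ./ m ℚᵘ.≃ j ℚᵘ./ n
*≡*-/ {m = suc _} {n = suc _} eq = *≡* eq

*≤*-/ : ∀ {i j m n} .{{_ : ℕ.NonZero m}} .{{_ : ℕ.NonZero n}} →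
        i ℕ.* n ℕ.≤ j ℕ.* m → + i ℚᵘ./ m ℚᵘ.≤ + j ℚᵘ./ n
*≤*-/ {i} {j} {suc _} {suc n-1} le =
  *≤* (subst₂ ℤ._≤_ (ℤ.pos-* i (suc n-1)) (ℤ.pos-* j _) (ℤ.+≤+ le))

≤-from-fractions : ∀ {x y i j m n} .{{_ : ℕ.NonZero m}} .{{_ : ℕ.NonZero n}} →
                   toℚᵘ x ℚᵘ.≃ + i ℚᵘ./ m → toℚᵘ y ℚᵘ.≃ + j ℚᵘ./ n → i ℕ.* n ℕ.≤ j ℕ.* m → x ≤ y
≤-from-fractions x≃i/m y≃j/n i*n≤j*m =
  ℚ.toℚᵘ-cancel-≤ (ℚᵘ.≤-respˡ-≃ (ℚᵘ.≃-sym x≃i/m) (ℚᵘ.≤-respʳ-≃ (ℚᵘ.≃-sym y≃j/n) (*≤*-/ i*n≤j*m)))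

toℚᵘ-+[k/1*z] : ∀ {x z m k b d} .{{_ : ℕ.NonZero b}} .{{_ : ℕ.NonZero d}} →
                toℚᵘ x ℚᵘ.≃ m ℚᵘ./ b → toℚᵘ z ℚᵘ.≃ 1ℤ ℚᵘ./ d →
                toℚᵘ (x + (k / 1) * z) ℚᵘ.≃ ((+ d ℤ.* m ℤ.+ k ℤ.* + b) ℚᵘ./ (b ℕ.* d)) {{ℕ.m*n≢0 b d}}
toℚᵘ-+[k/1*z] {x} {z} {m} {k} {b@(suc _)} {d@(suc _)} x≃m/b z≃1/d = begin
  toℚᵘ (x + (k / 1) * z)                                              ≈⟨ ℚ.toℚᵘ-homo-+ x ((k / 1) * z) ⟩
  toℚᵘ x ℚᵘ.+ toℚᵘ ((k / 1) * z)                                       ≈⟨ ℚᵘ.+-cong x≃m/b k/1*z≃ ⟩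
  (m ℤ.* + (1 ℕ.* d) ℤ.+ k ℤ.* 1ℤ ℤ.* + b) ℚᵘ./ (b ℕ.* (1 ℕ.* d))     ≈⟨ *≡*-/ eq ⟩
  (+ d ℤ.* m ℤ.+ k ℤ.* + b) ℚᵘ./ (b ℕ.* d)                             ∎
  where
  open ℚᵘ.≃-Reasoning
  k/1*z≃ : toℚᵘ ((k / 1) * z) ℚᵘ.≃ (k ℚᵘ./ 1) ℚᵘ.* (1ℤ ℚᵘ./ d)
  k/1*z≃ = ℚᵘ.≃-trans (ℚ.toℚᵘ-homo-* (k / 1) z) (ℚᵘ.*-cong (toℚᵘ-/ k 1) z≃1/d)
  eq : (m ℤ.* + (1 ℕ.* d) ℤ.+ k ℤ.* 1ℤ ℤ.* + b) ℤ.* + (b ℕ.* d) ≡ (+ d ℤ.* m ℤ.+ k ℤ.* + b) ℤ.* + (b ℕ.* (1 ℕ.* d))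
  eq = trans (cong₂ (λ e k′ → (m ℤ.* + e ℤ.+ k′ ℤ.* + b) ℤ.* + (b ℕ.* d)) (ℕ.*-identityˡ d) (ℤ.*-identityʳ k))
             (cong₂ (λ e f → (e ℤ.+ k ℤ.* + b) ℤ.* + (b ℕ.* f)) (ℤ.*-comm m (+ d)) (sym (ℕ.*-identityˡ d)))

toℚᵘ-invPow : ∀ p ℓ .{{_ : ℕ.NonZero p}} → toℚᵘ (invPow p ℓ) ℚᵘ.≃ (1ℤ ℚᵘ./ p ℕ.^ ℓ) {{ℕ.m^n≢0 p ℓ}}
toℚᵘ-invPow (suc q) ℓ = toℚᵘ-/ (+ 1) (suc q ℕ.^ ℓ) {{ℕ.m^n≢0 (suc q) ℓ}}

InpZp : ℕ → ℚ → Set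
InpZp p y = p ∣ ∣ ↥ y ∣

-- A `with` on a test of digitSearch makes Agda normalise the rational arithmetic in the goal, which is
-- prohibitively expensive; case analysis goes through if-does instead.
if-does : ∀ {P : Set} {A : Set} (Q : A → Set) (P? : Dec P) {x y : A} →
          (P → Q x) → (¬ P → Q y) → Q (if does P? then x else y)
if-does Q (yes p) p⇒Qx _ = p⇒Qx p
if-does Q (no ¬p) _ ¬p⇒Qy = ¬p⇒Qy ¬p

digitSearch<p : ∀ p .{{_ : ℕ.NonZero p}} x k → digitSearch p x k ℕ.< p
digitSearch<p p x zero = ℕ.>-nonZero⁻¹ p
digitSearch<p p@(suc p-1) x (suc k) =
  if-does (ℕ._< p) (p ∣? ∣ ↥ (x + ℕtoℚ (p ∸ suc k)) ∣) (λ _ → ℕ.s≤s (ℕ.m∸n≤m p-1 k)) (λ _ → digitSearch<p p x k)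

digit<p : ∀ p .{{_ : ℕ.NonZero p}} x → digit p x ℕ.< p
digit<p p x = digitSearch<p p x p

digitSearch-inpZp : ∀ {p x r} k → r ℕ.< p → p ℕ.≤ r ℕ.+ k →
                    InpZp p (x + ℕtoℚ r) → InpZp p (x + ℕtoℚ (digitSearch p x k))
digitSearch-inpZp {p} {x} {r} zero r<p p≤r+0 _ =
  ⊥-elim (ℕ.<⇒≱ r<p (subst (p ℕ.≤_) (ℕ.+-identityʳ r) p≤r+0))
digitSearch-inpZp {p} {x} {r} (suc k) r<p p≤r+1+k x+r∈pZp =
  if-does (λ c → InpZp p (x + ℕtoℚ c)) (p ∣? ∣ ↥ (x + ℕtoℚ (p ∸ suc k)) ∣) id
          (λ p∤ → digitSearch-inpZp {x = x} k r<p (p≤r+k p∤) x+r∈pZp)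
  where
  p≤r+k : ¬ InpZp p (x + ℕtoℚ (p ∸ suc k)) → p ℕ.≤ r ℕ.+ k
  p≤r+k p∤ = ℕ.s≤s⁻¹ (ℕ.≤∧≢⇒< (subst (p ℕ.≤_) (ℕ.+-suc r k) p≤r+1+k) p≢1+r+k)
    where
    p≢1+r+k : p ≢ suc (r ℕ.+ k)
    p≢1+r+k p≡1+r+k = p∤ (subst (λ c → InpZp p (x + ℕtoℚ (c ∸ suc k))) (sym p≡1+r+k)
                            (subst (λ c → InpZp p (x + ℕtoℚ c)) (sym (ℕ.m+n∸n≡m r k)) x+r∈pZp))

digit-inpZp : ∀ {p x r} → r ℕ.< p → InpZp p (x + ℕtoℚ r) → InpZp p (x + ℕtoℚ (digit p x))
digit-inpZp {p} {x} {r} r<p = digitSearch-inpZp {x = x} p r<p (ℕ.m≤n+m p r)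

toℚᵘ-+ℕtoℚ : ∀ {x m b} .{{_ : ℕ.NonZero b}} r → toℚᵘ x ℚᵘ.≃ m ℚᵘ./ b →
             toℚᵘ (x + ℕtoℚ r) ℚᵘ.≃ (m ℤ.+ + r ℤ.* + b) ℚᵘ./ b
toℚᵘ-+ℕtoℚ {x} {m} {b@(suc _)} r x≃m/b = begin
  toℚᵘ (x + ℕtoℚ r)                          ≈⟨ ℚ.toℚᵘ-homo-+ x (ℕtoℚ r) ⟩
  toℚᵘ x ℚᵘ.+ toℚᵘ (ℕtoℚ r)                  ≈⟨ ℚᵘ.+-cong x≃m/b (toℚᵘ-/ (+ r) 1) ⟩
  (m ℤ.* 1ℤ ℤ.+ + r ℤ.* + b) ℚᵘ./ (b ℕ.* 1)  ≈⟨ *≡*-/ eq ⟩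
  (m ℤ.+ + r ℤ.* + b) ℚᵘ./ b                 ∎
  where
  open ℚᵘ.≃-Reasoning
  eq : (m ℤ.* 1ℤ ℤ.+ + r ℤ.* + b) ℤ.* + b ≡ (m ℤ.+ + r ℤ.* + b) ℤ.* + (b ℕ.* 1)
  eq rewrite ℤ.*-identityʳ m | ℕ.*-identityʳ b = refl

toℚᵘ-𝔇 : ∀ p .{{_ : ℕ.NonZero p}} {x n b} .{{_ : ℕ.NonZero b}} →
         toℚᵘ (x + ℕtoℚ (digit p x)) ℚᵘ.≃ (n ℤ.* + p) ℚᵘ./ b → toℚᵘ (𝔇 p x) ℚᵘ.≃ n ℚᵘ./ b
toℚᵘ-𝔇 p@(suc _) {x} {n} {b@(suc _)} x+r≃ = begin
  toℚᵘ (𝔇 p x)                                     ≈⟨ ℚ.toℚᵘ-homo-* (x + ℕtoℚ (digit p x)) (+ 1 / p) ⟩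
  toℚᵘ (x + ℕtoℚ (digit p x)) ℚᵘ.* toℚᵘ (+ 1 / p)  ≈⟨ ℚᵘ.*-cong x+r≃ (toℚᵘ-/ (+ 1) p) ⟩
  (n ℤ.* + p ℤ.* 1ℤ) ℚᵘ./ (b ℕ.* p)               ≡⟨ ℚᵘ./-cong (ℤ.*-identityʳ (n ℤ.* + p)) refl ⟩
  (n ℤ.* + p) ℚᵘ./ (b ℕ.* p)                      ≈⟨ ℚᵘ.*-cancelʳ-/ p ⟩
  n ℚᵘ./ b                                         ∎
  where open ℚᵘ.≃-Reasoning

∣↥∣*b≡∣n∣*↧ₙ : ∀ {y n b} .{{_ : ℕ.NonZero b}} → toℚᵘ y ℚᵘ.≃ n ℚᵘ./ b → ∣ ↥ y ∣ ℕ.* b ≡ ∣ n ∣ ℕ.* ↧ₙ y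
∣↥∣*b≡∣n∣*↧ₙ {mkℚ ν d-1 _} {n} {b@(suc _)} (*≡* νb≡nd) = begin
  ∣ ν ∣ ℕ.* b          ≡⟨ ℤ.abs-* ν (+ b) ⟨
  ∣ ν ℤ.* + b ∣        ≡⟨ cong ∣_∣ νb≡nd ⟩
  ∣ n ℤ.* + suc d-1 ∣  ≡⟨ ℤ.abs-* n (+ suc d-1) ⟩
  ∣ n ∣ ℕ.* suc d-1    ∎
  where open ≡-Reasoning

↧ₙ∣denominator : ∀ {y n b} .{{_ : ℕ.NonZero b}} → toℚᵘ y ℚᵘ.≃ n ℚᵘ./ b → ↧ₙ y ∣ b
↧ₙ∣denominator {y@(mkℚ _ _ coprime)} {n} y≃n/b =
  coprime-divisor (C.sym (recompute coprime)) (subst (↧ₙ y ∣_) (sym (∣↥∣*b≡∣n∣*↧ₙ {y} y≃n/b)) (n∣m*n ∣ n ∣))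

bézout⇒inverse : ∀ {p b} → Bézout.Identity 1 p b → ∃[ u ] + p ℤ.∣ u ℤ.* + b ℤ.- 1ℤ
bézout⇒inverse {p} {b} (Bézout.+- x y 1+yb≡xp) =
  ℤ.- + y , ℤ.divides (ℤ.- + x) (negated (+ y) (+ b) (+ x) (+ p) (pos-1+*≡* y b x p 1+yb≡xp))
  where
  negated : ∀ Y B X P → 1ℤ ℤ.+ Y ℤ.* B ≡ X ℤ.* P → ℤ.- Y ℤ.* B ℤ.- 1ℤ ≡ ℤ.- X ℤ.* P
  negated Y B X P eq = begin
    ℤ.- Y ℤ.* B ℤ.- 1ℤ    ≡⟨ solve (Y ∷ B ∷ []) ⟩
    ℤ.- (1ℤ ℤ.+ Y ℤ.* B)  ≡⟨ cong ℤ.-_ eq ⟩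
    ℤ.- (X ℤ.* P)         ≡⟨ ℤ.neg-distribˡ-* X P ⟩
    ℤ.- X ℤ.* P           ∎
    where open ≡-Reasoning
bézout⇒inverse {p} {b} (Bézout.-+ x y 1+xp≡yb) =
  + y , ℤ.divides (+ x) (shifted (+ x) (+ p) (+ y) (+ b) (pos-1+*≡* x p y b 1+xp≡yb))
  where
  shifted : ∀ X P Y B → 1ℤ ℤ.+ X ℤ.* P ≡ Y ℤ.* B → Y ℤ.* B ℤ.- 1ℤ ≡ X ℤ.* P
  shifted X P Y B eq = begin
    Y ℤ.* B ℤ.- 1ℤ             ≡⟨ cong (ℤ._- 1ℤ) eq ⟨
    1ℤ ℤ.+ X ℤ.* P ℤ.- 1ℤ      ≡⟨ solve (X ∷ P ∷ []) ⟩
    X ℤ.* P                    ∎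
    where open ≡-Reasoning

digit-exists : ∀ {p} .{{_ : ℕ.NonZero p}} b → ∃[ u ] + p ℤ.∣ u ℤ.* + b ℤ.- 1ℤ →
               ∀ m → ∃[ r ] r ℕ.< p × p ∣ ∣ m ℤ.+ + r ℤ.* + b ∣
digit-exists {p} b (u , p∣ub-1) m =
  r , ℤ.n%ℕd<d X p , ℤ.∣⇒∣ᵤ (subst (+ p ℤ.∣_) (sym m+rb≡) p∣rhs)
  where
  X : ℤ
  X = ℤ.- (m ℤ.* u)
  r : ℕ
  r = X ℤ.%ℕ p
  q : ℤ
  q = X ℤ./ℕ p
  identity : ∀ m u R Q B P → ℤ.- (m ℤ.* u) ≡ R ℤ.+ Q ℤ.* P →
             m ℤ.+ R ℤ.* B ≡ ℤ.- m ℤ.* (u ℤ.* B ℤ.- 1ℤ) ℤ.- Q ℤ.* B ℤ.* P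
  identity m u R Q B P eq = begin
    m ℤ.+ R ℤ.* B                                 ≡⟨ solve (m ∷ R ∷ Q ∷ B ∷ P ∷ []) ⟩
    m ℤ.+ (R ℤ.+ Q ℤ.* P) ℤ.* B ℤ.- Q ℤ.* B ℤ.* P  ≡⟨ cong (λ z → m ℤ.+ z ℤ.* B ℤ.- Q ℤ.* B ℤ.* P) eq ⟨
    m ℤ.+ ℤ.- (m ℤ.* u) ℤ.* B ℤ.- Q ℤ.* B ℤ.* P    ≡⟨ solve (m ∷ u ∷ Q ∷ B ∷ P ∷ []) ⟩
    ℤ.- m ℤ.* (u ℤ.* B ℤ.- 1ℤ) ℤ.- Q ℤ.* B ℤ.* P   ∎
    where open ≡-Reasoning
  m+rb≡ : m ℤ.+ + r ℤ.* + b ≡ ℤ.- m ℤ.* (u ℤ.* + b ℤ.- 1ℤ) ℤ.- q ℤ.* + b ℤ.* + p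
  m+rb≡ = identity m u (+ r) q (+ b) (+ p) (ℤ.a≡a%ℕn+[a/ℕn]*n X p)
  p∣rhs : + p ℤ.∣ ℤ.- m ℤ.* (u ℤ.* + b ℤ.- 1ℤ) ℤ.- q ℤ.* + b ℤ.* + p
  p∣rhs = ℤ.∣m∣n⇒∣m-n (ℤ.∣n⇒∣m*n (ℤ.- m) p∣ub-1) (ℤ.∣n⇒∣m*n (q ℤ.* + b) ℤ.∣-refl)

record Orbit (p : ℕ) (a : ℤ) (b : ℕ) .{{_ : ℕ.NonZero b}} (ℓ : ℕ) (x : ℚ) : Set where
  field
    N         : ℕ
    m         : ℤ
    N<p^ℓ     : N ℕ.< p ℕ.^ ℓ
    x≃m/b     : toℚᵘ x ℚᵘ.≃ m ℚᵘ./ b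
    p^ℓm≡a+Nb : + (p ℕ.^ ℓ) ℤ.* m ≡ a ℤ.+ + N ℤ.* + b

orbit-start : ∀ {p a b x} .{{_ : ℕ.NonZero b}} → toℚᵘ x ℚᵘ.≃ a ℚᵘ./ b → Orbit p a b 0 x
orbit-start {a = a} x≃a/b = record
  { N = 0 ; m = a ; N<p^ℓ = ℕ.s≤s ℕ.z≤n ; x≃m/b = x≃a/b
  ; p^ℓm≡a+Nb = trans (ℤ.*-identityˡ a) (sym (ℤ.+-identityʳ a)) }

carry-step : ∀ a m m′ N r B P p → P ℤ.* m ≡ a ℤ.+ N ℤ.* B → m ℤ.+ r ℤ.* B ≡ m′ ℤ.* p →
             p ℤ.* P ℤ.* m′ ≡ a ℤ.+ (N ℤ.+ r ℤ.* P) ℤ.* B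
carry-step a m m′ N r B P p Pm≡a+NB m+rB≡m′p = begin
  p ℤ.* P ℤ.* m′                  ≡⟨ solve (p ∷ P ∷ m′ ∷ []) ⟩
  P ℤ.* (m′ ℤ.* p)                ≡⟨ cong (P ℤ.*_) m+rB≡m′p ⟨
  P ℤ.* (m ℤ.+ r ℤ.* B)           ≡⟨ solve (P ∷ m ∷ r ∷ B ∷ []) ⟩
  P ℤ.* m ℤ.+ r ℤ.* P ℤ.* B       ≡⟨ cong (λ z → z ℤ.+ r ℤ.* P ℤ.* B) Pm≡a+NB ⟩
  a ℤ.+ N ℤ.* B ℤ.+ r ℤ.* P ℤ.* B ≡⟨ solve (a ∷ N ∷ B ∷ r ∷ P ∷ []) ⟩
  a ℤ.+ (N ℤ.+ r ℤ.* P) ℤ.* B     ∎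
  where open ≡-Reasoning

module _ {p b : ℕ} .{{_ : ℕ.NonZero b}} (p-prime : Prime p) (p∤b : ¬ p ∣ b) where

  private instance
    p≢0 : ℕ.NonZero p
    p≢0 = prime⇒nonZero p-prime

  coprime[p,b] : Coprime p b
  coprime[p,b] (d∣p , d∣b) with prime⇒irreducible p-prime d∣p
  ... | inj₁ d≡1 = d≡1
  ... | inj₂ refl = ⊥-elim (p∤b d∣b)

  inpZp⇒p∣numerator : ∀ {y n} → toℚᵘ y ℚᵘ.≃ n ℚᵘ./ b → InpZp p y → p ∣ ∣ n ∣
  inpZp⇒p∣numerator {y} {n} y≃n/b p∣↥y
    with euclidsLemma ∣ n ∣ (↧ₙ y) p-prime (subst (p ∣_) (∣↥∣*b≡∣n∣*↧ₙ {y} y≃n/b) (∣-trans p∣↥y (m∣m*n b)))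
  ... | inj₁ p∣n = p∣n
  ... | inj₂ p∣↧y = ⊥-elim (p∤b (∣-trans p∣↧y (↧ₙ∣denominator {y} y≃n/b)))

  p∣numerator⇒inpZp : ∀ {y n} → toℚᵘ y ℚᵘ.≃ n ℚᵘ./ b → p ∣ ∣ n ∣ → InpZp p y
  p∣numerator⇒inpZp {y} {n} y≃n/b p∣n
    with euclidsLemma ∣ ↥ y ∣ b p-prime (subst (p ∣_) (sym (∣↥∣*b≡∣n∣*↧ₙ {y} y≃n/b)) (∣-trans p∣n (m∣m*n (↧ₙ y))))
  ... | inj₁ p∣↥y = p∣↥y
  ... | inj₂ p∣b = ⊥-elim (p∤b p∣b)

  p∣m+digit*b : ∀ {x m} → toℚᵘ x ℚᵘ.≃ m ℚᵘ./ b → p ∣ ∣ m ℤ.+ + digit p x ℤ.* + b ∣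
  p∣m+digit*b {x} {m} x≃m/b = from-some-digit (digit-exists b (bézout⇒inverse (coprime-Bézout coprime[p,b])) m)
    where
    from-some-digit : ∃[ r ] r ℕ.< p × p ∣ ∣ m ℤ.+ + r ℤ.* + b ∣ → p ∣ ∣ m ℤ.+ + digit p x ℤ.* + b ∣
    from-some-digit (r , r<p , p∣m+rb) =
      inpZp⇒p∣numerator {x + ℕtoℚ (digit p x)} (toℚᵘ-+ℕtoℚ (digit p x) x≃m/b)
        (digit-inpZp {x = x} r<p (p∣numerator⇒inpZp {x + ℕtoℚ r} (toℚᵘ-+ℕtoℚ r x≃m/b) p∣m+rb))

  orbit-step : ∀ {a ℓ x} → Orbit p a b ℓ x → Orbit p a b (suc ℓ) (𝔇 p x)
  orbit-step {a} {ℓ} {x} o = record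
    { N = N ℕ.+ r ℕ.* P
    ; m = m′
    ; N<p^ℓ = ℕ.<-≤-trans (ℕ.+-monoˡ-< (r ℕ.* P) N<p^ℓ) (ℕ.*-monoˡ-≤ P (digit<p p x))
    ; x≃m/b = toℚᵘ-𝔇 p (subst (λ n → toℚᵘ (x + ℕtoℚ r) ℚᵘ.≃ n ℚᵘ./ b) m+rb≡m′p (toℚᵘ-+ℕtoℚ r x≃m/b))
    ; p^ℓm≡a+Nb = begin
        + (p ℕ.* P) ℤ.* m′                      ≡⟨ cong (ℤ._* m′) (ℤ.pos-* p P) ⟩
        + p ℤ.* + P ℤ.* m′                      ≡⟨ carry-step a m m′ (+ N) (+ r) (+ b) (+ P) (+ p) p^ℓm≡a+Nb m+rb≡m′p ⟩
        a ℤ.+ (+ N ℤ.+ + r ℤ.* + P) ℤ.* + b     ≡⟨ cong (λ z → a ℤ.+ z ℤ.* + b) N+rP≡ ⟨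
        a ℤ.+ + (N ℕ.+ r ℕ.* P) ℤ.* + b         ∎
    }
    where
    open Orbit o
    open ≡-Reasoning
    P : ℕ
    P = p ℕ.^ ℓ
    r : ℕ
    r = digit p x
    p∣m+rb : + p ℤ.∣ m ℤ.+ + r ℤ.* + b
    p∣m+rb = ℤ.∣ᵤ⇒∣ (p∣m+digit*b x≃m/b)
    m′ : ℤ
    m′ = ℤ.quotient p∣m+rb
    m+rb≡m′p : m ℤ.+ + r ℤ.* + b ≡ m′ ℤ.* + p
    m+rb≡m′p = ℤ._∣_.equality p∣m+rb
    N+rP≡ : + (N ℕ.+ r ℕ.* P) ≡ + N ℤ.+ + r ℤ.* + P
    N+rP≡ = trans (ℤ.pos-+ N (r ℕ.* P)) (cong (ℤ._+_ (+ N)) (ℤ.pos-* r P))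

  orbit : ∀ {a x} → toℚᵘ x ℚᵘ.≃ a ℚᵘ./ b → ∀ ℓ → Orbit p a b ℓ (𝔇^ p ℓ x)
  orbit x≃a/b zero    = orbit-start x≃a/b
  orbit x≃a/b (suc ℓ) = orbit-step (orbit x≃a/b ℓ)

orbit-numerator≢0 : ∀ {p a b ℓ x α} .{{_ : ℕ.NonZero b}} → toℚᵘ α ℚᵘ.≃ a ℚᵘ./ b →
                    ¬ (∃[ n ] α ≡ - ℕtoℚ n) → (o : Orbit p a b ℓ x) → Orbit.m o ≢ 0ℤ
orbit-numerator≢0 {p} {a} {b@(suc _)} {ℓ} {α = α} α≃a/b α≢-n o m≡0 = α≢-n (N , α≡-N)
  where
  open Orbit o
  a+Nb≡0 : a ℤ.+ + N ℤ.* + b ≡ 0ℤ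
  a+Nb≡0 = trans (sym p^ℓm≡a+Nb) (trans (cong (+ (p ℕ.^ ℓ) ℤ.*_) m≡0) (ℤ.*-zeroʳ (+ (p ℕ.^ ℓ))))
  a≡-Nb : a ℤ.* 1ℤ ≡ ℤ.- + N ℤ.* + b
  a≡-Nb = begin
    a ℤ.* 1ℤ                                ≡⟨ ℤ.*-identityʳ a ⟩
    a                                       ≡⟨ [i+j]-j≡i a (+ N ℤ.* + b) ⟨
    a ℤ.+ + N ℤ.* + b ℤ.- + N ℤ.* + b        ≡⟨ cong (ℤ._- + N ℤ.* + b) a+Nb≡0 ⟩
    0ℤ ℤ.- + N ℤ.* + b                       ≡⟨ ℤ.+-identityˡ (ℤ.- (+ N ℤ.* + b)) ⟩
    ℤ.- (+ N ℤ.* + b)                        ≡⟨ ℤ.neg-distribˡ-* (+ N) (+ b) ⟩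
    ℤ.- + N ℤ.* + b                          ∎
    where open ≡-Reasoning
  α≡-N : α ≡ - ℕtoℚ N
  α≡-N = ℚ.toℚᵘ-injective (begin
    toℚᵘ α                  ≈⟨ α≃a/b ⟩
    a ℚᵘ./ b                ≈⟨ *≡*-/ a≡-Nb ⟩
    ℚᵘ.- (+ N ℚᵘ./ 1)       ≈⟨ ℚᵘ.-‿cong (toℚᵘ-/ (+ N) 1) ⟨
    ℚᵘ.- toℚᵘ (ℕtoℚ N)      ≈⟨ ℚ.toℚᵘ-homo‿- (ℕtoℚ N) ⟨
    toℚᵘ (- ℕtoℚ N)         ∎)
    where open ℚᵘ.≃-Reasoning

floor-bounds : ∀ {y n b} .{{_ : ℕ.NonZero b}} → toℚᵘ y ℚᵘ.≃ n ℚᵘ./ b →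
               floor y ℤ.* + b ℤ.≤ n × n ℤ.< (1ℤ ℤ.+ floor y) ℤ.* + b
floor-bounds {y@(mkℚ ν d-1 _)} {n} {b@(suc _)} (*≡* νb≡nd) = lower , upper
  where
  open ℤ.≤-Reasoning
  d : ℕ
  d = suc d-1
  lower : floor y ℤ.* + b ℤ.≤ n
  lower = ℤ.*-cancelʳ-≤-pos (floor y ℤ.* + b) n (+ d) (begin
    floor y ℤ.* + b ℤ.* + d  ≡⟨ xy∙z≈xz∙y (floor y) (+ b) (+ d) ⟩
    floor y ℤ.* + d ℤ.* + b  ≤⟨ ℤ.*-monoʳ-≤-nonNeg (+ b) (ℤ.[n/d]*d≤n ν (+ d)) ⟩
    ν ℤ.* + b                ≡⟨ νb≡nd ⟩
    n ℤ.* + d                ∎)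
  upper : n ℤ.< (1ℤ ℤ.+ floor y) ℤ.* + b
  upper = ℤ.*-cancelʳ-<-nonNeg (+ d) (begin-strict
    n ℤ.* + d                          ≡⟨ νb≡nd ⟨
    ν ℤ.* + b                          <⟨ ℤ.*-monoʳ-<-pos (+ b) (ℤ.n<s[n/ℕd]*d ν d) ⟩
    (1ℤ ℤ.+ ν ℤ./ℕ d) ℤ.* + d ℤ.* + b  ≡⟨ xy∙z≈xz∙y (1ℤ ℤ.+ ν ℤ./ℕ d) (+ d) (+ b) ⟩
    (1ℤ ℤ.+ ν ℤ./ℕ d) ℤ.* + b ℤ.* + d  ≡⟨ cong (λ f → (1ℤ ℤ.+ f) ℤ.* + b ℤ.* + d) (ℤ.div-pos-is-/ℕ ν d) ⟨
    (1ℤ ℤ.+ floor y) ℤ.* + b ℤ.* + d   ∎)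

0<a+kB≤B : ∀ a k B → k ℤ.* B ℤ.≤ B ℤ.- a → B ℤ.- a ℤ.< (1ℤ ℤ.+ k) ℤ.* B →
           0ℤ ℤ.< a ℤ.+ k ℤ.* B × a ℤ.+ k ℤ.* B ℤ.≤ B
0<a+kB≤B a k B kB≤B-a B-a<[1+k]B = positive , bounded
  where
  open ℤ.≤-Reasoning
  positive : 0ℤ ℤ.< a ℤ.+ k ℤ.* B
  positive = begin-strict
    0ℤ                                  ≡⟨ solve (a ∷ B ∷ []) ⟩
    ℤ.- B ℤ.+ (B ℤ.- a ℤ.+ a)            <⟨ ℤ.+-monoʳ-< (ℤ.- B) (ℤ.+-monoˡ-< a B-a<[1+k]B) ⟩
    ℤ.- B ℤ.+ ((1ℤ ℤ.+ k) ℤ.* B ℤ.+ a)   ≡⟨ solve (a ∷ k ∷ B ∷ []) ⟩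
    a ℤ.+ k ℤ.* B                       ∎
  bounded : a ℤ.+ k ℤ.* B ℤ.≤ B
  bounded = begin
    a ℤ.+ k ℤ.* B    ≤⟨ ℤ.+-monoʳ-≤ a kB≤B-a ⟩
    a ℤ.+ (B ℤ.- a)  ≡⟨ solve (a ∷ B ∷ []) ⟩
    B                ∎

0<i≤+n⇒i≡+s : ∀ {i n} → 0ℤ ℤ.< i → i ℤ.≤ + n → ∃[ s ] 1 ℕ.≤ s × s ℕ.≤ n × i ≡ + s
0<i≤+n⇒i≡+s {+ s} (ℤ.+<+ 0<s) (ℤ.+≤+ s≤n) = s , 0<s , s≤n , refl

a+⌊1-α⌋b∈[1,b] : ∀ {α a b} .{{_ : ℕ.NonZero b}} → toℚᵘ α ℚᵘ.≃ a ℚᵘ./ b →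
                   ∃[ s ] 1 ℕ.≤ s × s ℕ.≤ b × a ℤ.+ floor (1ℚ - α) ℤ.* + b ≡ + s
a+⌊1-α⌋b∈[1,b] {α} {a} {b@(suc _)} α≃a/b =
  0<i≤+n⇒i≡+s (proj₁ a+kb-bounds) (proj₂ a+kb-bounds)
  where
  eq : (1ℤ ℤ.* + b ℤ.+ ℤ.- a ℤ.* 1ℤ) ℤ.* + b ≡ (+ b ℤ.- a) ℤ.* + (1 ℕ.* b)
  eq rewrite ℤ.*-identityˡ (+ b) | ℤ.*-identityʳ (ℤ.- a) | ℕ.*-identityˡ b = refl
  1-α≃ : toℚᵘ (1ℚ - α) ℚᵘ.≃ (+ b ℤ.- a) ℚᵘ./ b
  1-α≃ = begin
    toℚᵘ (1ℚ - α)                                      ≈⟨ ℚ.toℚᵘ-homo-+ 1ℚ (- α) ⟩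
    toℚᵘ 1ℚ ℚᵘ.+ toℚᵘ (- α)                             ≈⟨ ℚᵘ.+-congʳ (toℚᵘ 1ℚ) (ℚᵘ.≃-trans (ℚ.toℚᵘ-homo‿- α) (ℚᵘ.-‿cong α≃a/b)) ⟩
    (1ℤ ℤ.* + b ℤ.+ ℤ.- a ℤ.* 1ℤ) ℚᵘ./ (1 ℕ.* b)        ≈⟨ *≡*-/ eq ⟩
    (+ b ℤ.- a) ℚᵘ./ b                                 ∎
    where open ℚᵘ.≃-Reasoning
  k : ℤ
  k = floor (1ℚ - α)
  a+kb-bounds : 0ℤ ℤ.< a ℤ.+ k ℤ.* + b × a ℤ.+ k ℤ.* + b ℤ.≤ + b
  a+kb-bounds = 0<a+kB≤B a k (+ b) (proj₁ (floor-bounds 1-α≃)) (proj₂ (floor-bounds 1-α≃))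

numerator≤denominator : ∀ {s N b P} → s ℕ.≤ b → N ℕ.< P → s ℕ.+ N ℕ.* b ℕ.≤ b ℕ.* P
numerator≤denominator {s} {N} {b} {P} s≤b N<P = begin
  s ℕ.+ N ℕ.* b  ≤⟨ ℕ.+-monoˡ-≤ (N ℕ.* b) s≤b ⟩
  suc N ℕ.* b    ≤⟨ ℕ.*-monoˡ-≤ b N<P ⟩
  P ℕ.* b        ≡⟨ ℕ.*-comm P b ⟩
  b ℕ.* P        ∎
  where open ℕ.≤-Reasoning

P≤n*[1+∣k∣b] : ∀ {P m n k b} → m ≢ 0ℤ → 1 ℕ.≤ n → + P ℤ.* m ℤ.+ k ℤ.* + b ≡ + n →
               P ℕ.≤ n ℕ.* suc (∣ k ∣ ℕ.* b)
P≤n*[1+∣k∣b] {P} {m} {n} {k} {b} m≢0 1≤n Pm+kb≡n = begin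
  P                                          ≤⟨ ℕ.m≤m*n P ∣ m ∣ {{ℕ.≢-nonZero (m≢0 ∘ ℤ.∣i∣≡0⇒i≡0)}} ⟩
  P ℕ.* ∣ m ∣                                ≡⟨ ℤ.abs-* (+ P) m ⟨
  ∣ + P ℤ.* m ∣                              ≡⟨ cong ∣_∣ ([i+j]-j≡i (+ P ℤ.* m) (k ℤ.* + b)) ⟨
  ∣ + P ℤ.* m ℤ.+ k ℤ.* + b ℤ.- k ℤ.* + b ∣  ≡⟨ cong (λ i → ∣ i ℤ.- k ℤ.* + b ∣) Pm+kb≡n ⟩
  ∣ + n ℤ.- k ℤ.* + b ∣                      ≤⟨ ℤ.∣i-j∣≤∣i∣+∣j∣ (+ n) (k ℤ.* + b) ⟩
  n ℕ.+ ∣ k ℤ.* + b ∣                        ≡⟨ cong (n ℕ.+_) (ℤ.abs-* k (+ b)) ⟩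
  n ℕ.+ ∣ k ∣ ℕ.* b                          ≤⟨ ℕ.+-monoʳ-≤ n (ℕ.m≤n*m (∣ k ∣ ℕ.* b) n {{ℕ.>-nonZero 1≤n}}) ⟩
  n ℕ.+ n ℕ.* (∣ k ∣ ℕ.* b)                  ≡⟨ ℕ.*-suc n (∣ k ∣ ℕ.* b) ⟨
  n ℕ.* suc (∣ k ∣ ℕ.* b)                    ∎
  where open ℕ.≤-Reasoning

X+kB≡S+NB : ∀ X a N B k S → X ≡ a ℤ.+ N ℤ.* B → a ℤ.+ k ℤ.* B ≡ S → X ℤ.+ k ℤ.* B ≡ S ℤ.+ N ℤ.* B
X+kB≡S+NB X a N B k S X≡a+NB a+kB≡S = begin
  X ℤ.+ k ℤ.* B               ≡⟨ cong (ℤ._+ k ℤ.* B) X≡a+NB ⟩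
  a ℤ.+ N ℤ.* B ℤ.+ k ℤ.* B   ≡⟨ solve (a ∷ N ∷ B ∷ k ∷ []) ⟩
  a ℤ.+ k ℤ.* B ℤ.+ N ℤ.* B   ≡⟨ cong (ℤ._+ N ℤ.* B) a+kB≡S ⟩
  S ℤ.+ N ℤ.* B               ∎
  where open ≡-Reasoning

Mₙ : ℚ → ℕ
Mₙ α = ↧ₙ α ℕ.* suc (∣ floor (1ℚ - α) ∣ ℕ.* ↧ₙ α)

M : ℚ → ℚ
M α = mkℚ (+ Mₙ α) 0 (C.sym (C.1-coprimeTo (Mₙ α)))

M>0 : ∀ α → 0ℚ < M α
M>0 α = *<* (ℤ.+<+ (ℕ.s≤s ℕ.z≤n))

dwork-bounds : ∀ α → ¬ (∃[ n ] (α ≡ - ℕtoℚ n)) → ∀ p → Prime p → InZp p α → ∀ ℓ →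
  ((1/ M α) {{>-nonZero (M>0 α)}} ≤ 𝔇^ p ℓ α + ((floor (1ℚ - α) / 1) * invPow p ℓ))
  × (𝔇^ p ℓ α + ((floor (1ℚ - α) / 1) * invPow p ℓ) ≤ 1ℚ)
dwork-bounds α@(mkℚ a b-1 _) α≢-n p p-prime p∤b ℓ = lower , upper
  where
  b : ℕ
  b = suc b-1
  k : ℤ
  k = floor (1ℚ - α)
  P : ℕ
  P = p ℕ.^ ℓ
  instance
    p≢0 : ℕ.NonZero p
    p≢0 = prime⇒nonZero p-prime
    P≢0 : ℕ.NonZero P
    P≢0 = ℕ.m^n≢0 p ℓ
    bP≢0 : ℕ.NonZero (b ℕ.* P)
    bP≢0 = ℕ.m*n≢0 b P
  α≃a/b : toℚᵘ α ℚᵘ.≃ a ℚᵘ./ b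
  α≃a/b = ℚᵘ.≃-refl
  orbit[α] : Orbit p a b ℓ (𝔇^ p ℓ α)
  orbit[α] = orbit p-prime p∤b α≃a/b ℓ
  open Orbit orbit[α]
  shift : ∃[ s ] 1 ℕ.≤ s × s ℕ.≤ b × a ℤ.+ k ℤ.* + b ≡ + s
  shift = a+⌊1-α⌋b∈[1,b] α≃a/b
  s : ℕ
  s = proj₁ shift
  1≤s : 1 ℕ.≤ s
  1≤s = proj₁ (proj₂ shift)
  s≤b : s ℕ.≤ b
  s≤b = proj₁ (proj₂ (proj₂ shift))
  a+kb≡s : a ℤ.+ k ℤ.* + b ≡ + s
  a+kb≡s = proj₂ (proj₂ (proj₂ shift))
  n : ℕ
  n = s ℕ.+ N ℕ.* b
  numerator≡n : + P ℤ.* m ℤ.+ k ℤ.* + b ≡ + n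
  numerator≡n = trans (X+kB≡S+NB _ a (+ N) (+ b) k (+ s) p^ℓm≡a+Nb a+kb≡s)
                      (sym (trans (ℤ.pos-+ s (N ℕ.* b)) (cong (ℤ._+_ (+ s)) (ℤ.pos-* N b))))
  V≃ : toℚᵘ (𝔇^ p ℓ α + (k / 1) * invPow p ℓ) ℚᵘ.≃ + n ℚᵘ./ (b ℕ.* P)
  V≃ = ℚᵘ.≃-trans (toℚᵘ-+[k/1*z] {k = k} x≃m/b (toℚᵘ-invPow p ℓ)) (ℚᵘ.≃-reflexive (ℚᵘ./-cong numerator≡n refl))
  1≤n : 1 ℕ.≤ n
  1≤n = ℕ.≤-trans 1≤s (ℕ.m≤m+n s (N ℕ.* b))
  upper : 𝔇^ p ℓ α + (k / 1) * invPow p ℓ ≤ 1ℚ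
  upper = ≤-from-fractions V≃ ℚᵘ.≃-refl (subst₂ ℕ._≤_ (sym (ℕ.*-identityʳ n)) (sym (ℕ.*-identityˡ (b ℕ.* P)))
            (numerator≤denominator s≤b N<p^ℓ))
  lower : (1/ M α) {{>-nonZero (M>0 α)}} ≤ 𝔇^ p ℓ α + (k / 1) * invPow p ℓ
  lower = ≤-from-fractions ℚᵘ.≃-refl V≃ (begin
    1 ℕ.* (b ℕ.* P)                       ≡⟨ ℕ.*-identityˡ (b ℕ.* P) ⟩
    b ℕ.* P                               ≤⟨ ℕ.*-monoʳ-≤ b (P≤n*[1+∣k∣b] {k = k} (orbit-numerator≢0 α≃a/b α≢-n orbit[α]) 1≤n numerator≡n) ⟩
    b ℕ.* (n ℕ.* suc (∣ k ∣ ℕ.* b))       ≡⟨ ℕ.*-assoc b n _ ⟨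
    b ℕ.* n ℕ.* suc (∣ k ∣ ℕ.* b)         ≡⟨ cong (ℕ._* suc (∣ k ∣ ℕ.* b)) (ℕ.*-comm b n) ⟩
    n ℕ.* b ℕ.* suc (∣ k ∣ ℕ.* b)         ≡⟨ ℕ.*-assoc n b _ ⟩
    n ℕ.* Mₙ α                            ∎)
    where open ℕ.≤-Reasoning

lemma4 : (α : ℚ) → ¬ (∃[ n ] (α ≡ - ℕtoℚ n)) →
    Σ ℚ λ M → Σ (0ℚ < M) λ M>0 →
      ∀ (p : ℕ) → Prime p → InZp p α → ∀ (ℓ : ℕ) → 1 ℕ.≤ ℓ →
        ((1/ M) {{>-nonZero M>0}} ≤ 𝔇^ p ℓ α + ((floor (1ℚ - α) / 1) * invPow p ℓ))
        × (𝔇^ p ℓ α + ((floor (1ℚ - α) / 1) * invPow p ℓ) ≤ 1ℚ)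
lemma4 α α≢-n = M α , M>0 α , λ p p-prime p∤b ℓ _ → dwork-bounds α α≢-n p p-prime p∤b ℓ
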